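{- For every small deficient set $U$, we have $|U\cap T|\le |T|/2$ and $|U^*\cap T|\ge (|T|-\ell)/2$.
   Context: Let $G=(V,E)$ be a finite undirected graph, $T\subseteq V$ a set of terminals and $\ell\ge 0$ an integer. Standing assumptions: $T$ is $\ell$-connected in $G$ (every pair of distinct terminals is joined by $\ell$ openly disjoint paths, i.e. paths sharing only their endpoints), $|T|\ge 2\ell$, and no two terminals are adjacent in $G$. For $U\subseteq V$, let $N(U)=\{v\in V\setminus U:\exists u\in U,\ uv\in E\}$ and $U^*=V\setminus(U\cup N(U))$. A deficient set is a set $U\subseteq V$ with $U\cap T\ne\emptyset$, $U^*\cap T\neq\emptyset$ and $|N(U)|<\ell+1$ (equivalently, by the $\ell$-connectivity of $T$, $|N(U)|=\ell$). A deficient set $U$ is small if $|U\cap T|\le |U^*\cap T|$. -}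

module Defs where

open import Data.Nat using (ℕ; zero; suc; _+_; _*_; _≤_; _<_)
open import Data.Bool using (Bool; true; false; _∧_; _∨_; not)
open import Data.Fin using (Fin; zero; suc)
open import Data.Fin.Subset using (Subset; _∈_; _∉_; _∩_; _∪_; ∁; ∣_∣)
open import Data.Vec using (Vec; lookup; tabulate)
open import Data.List using (List; []; _∷_; _++_; [_])
open import Data.List.Relation.Unary.Unique.Propositional using (Unique)
import Data.List.Membership.Propositional as LM
open import Data.Product using (Σ; _×_; _,_; ∃)
open import Relation.Binary.PropositionalEquality using (_≡_; _≢_)
open import Relation.Nullary using (¬_)

record Graph (n : ℕ) : Set where
  field
    adj      : Fin n → Fin n → Bool
    symmetric  : ∀ u v → adj u v ≡ adj v u
    irreflexive : ∀ v → adj v v ≡ false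

open Graph public

anyᵇ : ∀ {n} → (Fin n → Bool) → Bool
anyᵇ {zero}  f = false
anyᵇ {suc n} f = f zero ∨ anyᵇ (λ i → f (suc i))

Nbr : ∀ {n} → Graph n → Subset n → Subset n
Nbr G U = tabulate (λ v → not (lookup U v) ∧ anyᵇ (λ u → lookup U u ∧ adj G u v))

Star : ∀ {n} → Graph n → Subset n → Subset n
Star G U = ∁ (U ∪ Nbr G U)

-- IsWalk G s t xs : s, x₁, …, xₖ, t is a walk in G, where xs = x₁ … xₖ
-- are the interior vertices.
data IsWalk {n} (G : Graph n) : Fin n → Fin n → List (Fin n) → Set where
  edge : ∀ {s t} → adj G s t ≡ true → IsWalk G s t []
  step : ∀ {s v t xs} → adj G s v ≡ true → IsWalk G v t xs → IsWalk G s t (v ∷ xs)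

IsPath : ∀ {n} → Graph n → Fin n → Fin n → List (Fin n) → Set
IsPath G s t xs = IsWalk G s t xs × Unique (s ∷ xs ++ [ t ])

Disjoint : ∀ {n} → List (Fin n) → List (Fin n) → Set
Disjoint xs ys = ∀ v → v LM.∈ xs → ¬ (v LM.∈ ys)

-- k openly disjoint s–t paths: k paths (given by interiors) whose interiors
-- are pairwise disjoint, and which are pairwise distinct (at most one of
-- them is the single edge st).
OpenlyDisjointPaths : ∀ {n} → Graph n → Fin n → Fin n → ℕ → Set
OpenlyDisjointPaths {n} G s t k =
  Σ (Fin k → List (Fin n)) λ P →
    (∀ i → IsPath G s t (P i)) ×
    (∀ i j → i ≢ j → Disjoint (P i) (P j) × ¬ (P i ≡ [] × P j ≡ []))

Connected : ∀ {n} → Graph n → Subset n → ℕ → Set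
Connected G T ℓ = ∀ s t → s ∈ T → t ∈ T → s ≢ t → OpenlyDisjointPaths G s t ℓ

Independent : ∀ {n} → Graph n → Subset n → Set
Independent G T = ∀ s t → s ∈ T → t ∈ T → adj G s t ≡ false

Meets : ∀ {n} → Subset n → Subset n → Set
Meets A B = ∃ λ v → v ∈ A × v ∈ B

Deficient : ∀ {n} → Graph n → Subset n → ℕ → Subset n → Set
Deficient G T ℓ U = Meets U T × Meets (Star G U) T × ∣ Nbr G U ∣ < ℓ + 1

SmallDeficient : ∀ {n} → Graph n → Subset n → ℕ → Subset n → Set
SmallDeficient G T ℓ U =
  Deficient G T ℓ U × ∣ U ∩ T ∣ ≤ ∣ Star G U ∩ T ∣

-- U, N(U) and U* partition the vertex set, so the terminals split as
-- |U ∩ T| + |N(U) ∩ T| + |U* ∩ T| = |T| with |N(U) ∩ T| ≤ |N(U)| ≤ ℓ.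
-- Smallness |U ∩ T| ≤ |U* ∩ T| then gives both bounds by counting alone.
module Submission where

open import Defs
open import Data.Nat using (ℕ; _+_; _*_; _≤_; _<_; suc; s≤s; z≤n)
open import Data.Nat.Properties
open import Data.Fin.Subset using (Subset; _∩_; _∪_; ∁; ∣_∣; inside; outside)
open import Data.Fin.Subset.Properties
  using (∣p∩q∣≤∣p∣; ∣p∣≤∣p∪q∣; ∣p∣≤∣x∷p∣; ∩-distribʳ-∪)
open import Algebra.Properties.CommutativeSemigroup +-commutativeSemigroup using (xy∙z≈xz∙y)
open import Data.Product using (_×_; _,_)
open import Data.Vec using ([]; _∷_)
open import Relation.Binary.PropositionalEquality
  using (_≡_; refl; cong; sym; subst; module ≡-Reasoning)

∣p∪q∣≤∣p∣+∣q∣ : ∀ {n} (p q : Subset n) → ∣ p ∪ q ∣ ≤ ∣ p ∣ + ∣ q ∣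
∣p∪q∣≤∣p∣+∣q∣ []            []            = z≤n
∣p∪q∣≤∣p∣+∣q∣ (inside  ∷ p) (x       ∷ q) =
  s≤s (≤-trans (∣p∪q∣≤∣p∣+∣q∣ p q) (+-monoʳ-≤ ∣ p ∣ (∣p∣≤∣x∷p∣ x q)))
∣p∪q∣≤∣p∣+∣q∣ (outside ∷ p) (inside  ∷ q) =
  subst (suc ∣ p ∪ q ∣ ≤_) (sym (+-suc ∣ p ∣ ∣ q ∣)) (s≤s (∣p∪q∣≤∣p∣+∣q∣ p q))
∣p∪q∣≤∣p∣+∣q∣ (outside ∷ p) (outside ∷ q) = ∣p∪q∣≤∣p∣+∣q∣ p q

∣p∩r∣+∣∁p∩r∣≡∣r∣ : ∀ {n} (p r : Subset n) → ∣ p ∩ r ∣ + ∣ ∁ p ∩ r ∣ ≡ ∣ r ∣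
∣p∩r∣+∣∁p∩r∣≡∣r∣ []            []            = refl
∣p∩r∣+∣∁p∩r∣≡∣r∣ (inside  ∷ p) (inside  ∷ r) = cong suc (∣p∩r∣+∣∁p∩r∣≡∣r∣ p r)
∣p∩r∣+∣∁p∩r∣≡∣r∣ (outside ∷ p) (inside  ∷ r) = begin
  ∣ p ∩ r ∣ + suc ∣ ∁ p ∩ r ∣   ≡⟨ +-suc ∣ p ∩ r ∣ ∣ ∁ p ∩ r ∣ ⟩
  suc (∣ p ∩ r ∣ + ∣ ∁ p ∩ r ∣) ≡⟨ cong suc (∣p∩r∣+∣∁p∩r∣≡∣r∣ p r) ⟩
  suc ∣ r ∣                     ∎
  where open ≡-Reasoning
∣p∩r∣+∣∁p∩r∣≡∣r∣ (inside  ∷ p) (outside ∷ r) = ∣p∩r∣+∣∁p∩r∣≡∣r∣ p r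
∣p∩r∣+∣∁p∩r∣≡∣r∣ (outside ∷ p) (outside ∷ r) = ∣p∩r∣+∣∁p∩r∣≡∣r∣ p r

∣p∩r∣+∣∁[p∪q]∩r∣≤∣r∣ : ∀ {n} (p q r : Subset n) →
  ∣ p ∩ r ∣ + ∣ ∁ (p ∪ q) ∩ r ∣ ≤ ∣ r ∣
∣p∩r∣+∣∁[p∪q]∩r∣≤∣r∣ p q r = begin
  ∣ p ∩ r ∣ + ∣ ∁ (p ∪ q) ∩ r ∣         ≤⟨ +-monoˡ-≤ _ (∣p∣≤∣p∪q∣ (p ∩ r) (q ∩ r)) ⟩
  ∣ p ∩ r ∪ q ∩ r ∣ + ∣ ∁ (p ∪ q) ∩ r ∣ ≡⟨ cong (λ s → ∣ s ∣ + ∣ ∁ (p ∪ q) ∩ r ∣) (sym (∩-distribʳ-∪ r p q)) ⟩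
  ∣ (p ∪ q) ∩ r ∣ + ∣ ∁ (p ∪ q) ∩ r ∣     ≡⟨ ∣p∩r∣+∣∁p∩r∣≡∣r∣ (p ∪ q) r ⟩
  ∣ r ∣                                 ∎
  where open ≤-Reasoning

∣r∣≤∣p∩r∣+∣∁[p∪q]∩r∣+∣q∩r∣ : ∀ {n} (p q r : Subset n) →
  ∣ r ∣ ≤ ∣ p ∩ r ∣ + ∣ ∁ (p ∪ q) ∩ r ∣ + ∣ q ∩ r ∣
∣r∣≤∣p∩r∣+∣∁[p∪q]∩r∣+∣q∩r∣ p q r = begin
  ∣ r ∣                                     ≡⟨ sym (∣p∩r∣+∣∁p∩r∣≡∣r∣ (p ∪ q) r) ⟩
  ∣ (p ∪ q) ∩ r ∣ + ∣ ∁ (p ∪ q) ∩ r ∣       ≡⟨ cong (λ s → ∣ s ∣ + ∣ ∁ (p ∪ q) ∩ r ∣) (∩-distribʳ-∪ r p q) ⟩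
  ∣ p ∩ r ∪ q ∩ r ∣ + ∣ ∁ (p ∪ q) ∩ r ∣     ≤⟨ +-monoˡ-≤ _ (∣p∪q∣≤∣p∣+∣q∣ (p ∩ r) (q ∩ r)) ⟩
  ∣ p ∩ r ∣ + ∣ q ∩ r ∣ + ∣ ∁ (p ∪ q) ∩ r ∣ ≡⟨ xy∙z≈xz∙y (∣ p ∩ r ∣) (∣ q ∩ r ∣) (∣ ∁ (p ∪ q) ∩ r ∣) ⟩
  ∣ p ∩ r ∣ + ∣ ∁ (p ∪ q) ∩ r ∣ + ∣ q ∩ r ∣ ∎
  where open ≤-Reasoning

proposition6 : ∀ {n : ℕ} (G : Graph n) (T : Subset n) (ℓ : ℕ) →
    Connected G T ℓ → 2 * ℓ ≤ ∣ T ∣ → Independent G T →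
    ∀ (U : Subset n) → SmallDeficient G T ℓ U →
    (2 * ∣ U ∩ T ∣ ≤ ∣ T ∣) × (∣ T ∣ ≤ 2 * ∣ Star G U ∩ T ∣ + ℓ)
proposition6 {n} G T ℓ _ _ _ U ((_ , _ , ∣N∣<ℓ+1) , small) = terminals-in-U , terminals-in-U*
  where
  open ≤-Reasoning
  N : Subset n
  N = Nbr G U

  a b : ℕ
  a = ∣ U ∩ T ∣
  b = ∣ Star G U ∩ T ∣

  ∣N∩T∣≤ℓ : ∣ N ∩ T ∣ ≤ ℓ
  ∣N∩T∣≤ℓ = ≤-trans (∣p∩q∣≤∣p∣ N T) (m<1+n⇒m≤n (subst (∣ N ∣ <_) (+-comm ℓ 1) ∣N∣<ℓ+1))

  terminals-in-U : 2 * a ≤ ∣ T ∣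
  terminals-in-U = begin
    2 * a  ≡⟨ cong (a +_) (+-identityʳ a) ⟩
    a + a  ≤⟨ +-monoʳ-≤ a small ⟩
    a + b  ≤⟨ ∣p∩r∣+∣∁[p∪q]∩r∣≤∣r∣ U N T ⟩
    ∣ T ∣  ∎

  terminals-in-U* : ∣ T ∣ ≤ 2 * b + ℓ
  terminals-in-U* = begin
    ∣ T ∣               ≤⟨ ∣r∣≤∣p∩r∣+∣∁[p∪q]∩r∣+∣q∩r∣ U N T ⟩
    a + b + ∣ N ∩ T ∣   ≤⟨ +-mono-≤ (+-monoˡ-≤ b small) ∣N∩T∣≤ℓ ⟩
    b + b + ℓ           ≡⟨ cong (λ x → b + x + ℓ) (sym (+-identityʳ b)) ⟩
    2 * b + ℓ           ∎
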